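{- Let $X\subseteq\mathrm{PVAR}$ be finite, let $\alpha\ge|X|$, and let $\varphi\in\mathrm{Type}(X,\alpha)$ be a core type. Then $\neg\varphi$ is valid if and only if $\vdash_{\mathsf{C}}\neg\varphi$.
   Context: Syntax of $\mathrm{SL}(\ast,\mathrel{ -\!\!\ast})$: fix a countably infinite set $\mathrm{PVAR}$ of program variables and a countably infinite set $\mathrm{LOC}$ of locations. Formulae: $\varphi ::= x = y \mid x \hookrightarrow y \mid \mathrm{emp} \mid \neg\varphi \mid \varphi\wedge\varphi \mid \varphi \ast \varphi \mid \varphi \mathrel{ -\!\!\ast} \varphi$ ($x,y\in\mathrm{PVAR}$). Memory states $(s,h)$: $s:\mathrm{PVAR}\to\mathrm{LOC}$, $h$ a partial function $\mathrm{LOC}\to\mathrm{LOC}$ with finite domain. $(s,h)\models x=y$ iff $s(x)=s(y)$; $\models\mathrm{emp}$ iff $\mathrm{dom}(h)=\emptyset$; $\models x\hookrightarrow y$ iff $s(x)\in\mathrm{dom}(h)$ and $h(s(x))=s(y)$; Boolean connectives as usual; $\models\varphi_1\ast\varphi_2$ iff $h$ splits into two domain-disjoint heaps $h_1,h_2$ ($h=h_1+h_2$) with $(s,h_i)\models\varphi_i$; $\models\varphi_1\mathrel{ -\!\!\ast}\varphi_2$ iff for every $h_1$ with domain disjoint from $\mathrm{dom}(h)$ and $(s,h_1)\models\varphi_1$, $(s,h+h_1)\models\varphi_2$. Valid = satisfied by all memory states. Abbreviations: $\bot:=\neg(x=x)$, $\top:=\neg\bot$, $\mathrm{alloc}(x):=(x\hookrightarrow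 x)\mathrel{ -\!\!\ast}\bot$ (holds iff $s(x)\in\mathrm{dom}(h)$), $\mathrm{size}\ge0:=\top$, $\mathrm{size}\ge1:=\neg\mathrm{emp}$, $\mathrm{size}\ge\beta:=\neg\mathrm{emp}\ast\mathrm{size}\ge\beta-1$ for $\beta\ge2$ (holds iff $|\mathrm{dom}(h)|\ge\beta$). Core formulae: for finite $X\subseteq\mathrm{PVAR}$ and $\alpha\in\mathbb{N}$, $\mathrm{Core}(X,\alpha)=\{x=y,\ \mathrm{alloc}(x),\ x\hookrightarrow y,\ \mathrm{size}\ge\beta : x,y\in X,\ \beta\in[0,\alpha]\}$. A literal is a core formula or its negation. A core type in $\mathrm{Type}(X,\alpha)$ is a conjunction of literals over $\mathrm{Core}(X,\alpha)$ such that for every $\psi\in\mathrm{Core}(X,\alpha)$, exactly one of $\psi$, $\neg\psi$ occurs as a conjunct (and not both). The proof system $\mathsf{C}$ (derivability is the least set of formulae containing all instances of the axiom schemata and closed under the rules) consists of all axiom schemata of classical propositional calculus, modus ponens, and: (1) $x=x$; (2) $\varphi\wedge x=y\Rightarrow\varphi'$, where $\varphi'$ is obtained from $\varphi$ by replacing every occurrence of $y$ with $x$; (3) $x\hookrightarrow y\Rightarrow\mathrm{alloc}(x)$; (4) $(x\hookrightarrow y\wedge x\hookrightarrow z)\Rightarrow y=z$; (5) $\mathrm{size}\ge\beta+1\Rightarrow\mathrm{size}\ge\beta$ for $\beta\in\mathbb{N}$; (6) $\bigwedge_{x\in X}(\mathrm{alloc}(x)\wedge\bigwedge_{y\in X\setminus\{x\}}\neg(x=y))\Rightarrow\mathrm{size}\ge|X|$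 for finite $X\subseteq\mathrm{PVAR}$. -}

module Defs where

open import Data.Nat using (ℕ; zero; suc; _≤_; _≟_)
open import Data.Bool using (Bool; true; false; not; _∧_; if_then_else_)
open import Data.Maybe using (Maybe; just; nothing)
open import Data.List using (List; []; _∷_; map; filter; length)
open import Data.List.Membership.Propositional using (_∈_)
open import Data.List.Relation.Unary.Unique.Propositional using (Unique)
open import Data.Product using (Σ; ∃; _×_; _,_)
open import Data.Sum using (_⊎_)
open import Relation.Nullary using (¬_; ¬?; does)
open import Relation.Binary.PropositionalEquality using (_≡_)

PVar : Set
PVar = ℕ

Loc : Set
Loc = ℕ

infix  8 _≐_ _↪_
infix  7 ¬'_
infixr 6 _∧'_
infixr 5 _✶_ _−✶_
infixr 4 _⇒_

data Form : Set where
  _≐_  : PVar → PVar → Form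
  _↪_  : PVar → PVar → Form
  emp  : Form
  ¬'_  : Form → Form
  _∧'_ : Form → Form → Form
  _✶_  : Form → Form → Form
  _−✶_ : Form → Form → Form

_⇒_ : Form → Form → Form
φ ⇒ ψ = ¬' (φ ∧' ¬' ψ)

⊥' : Form
⊥' = ¬' (0 ≐ 0)

⊤' : Form
⊤' = ¬' ⊥'

alloc : PVar → Form
alloc x = (x ↪ x) −✶ ⊥'

size≥ : ℕ → Form
size≥ zero = ⊤'
size≥ (suc zero) = ¬' emp
size≥ (suc (suc β)) = ¬' emp ✶ size≥ (suc β)

Conj : List Form → Form
Conj [] = ⊤'
Conj (φ ∷ []) = φ
Conj (φ ∷ ψ ∷ ψs) = φ ∧' Conj (ψ ∷ ψs)

Store : Set
Store = PVar → Loc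

record Heap : Set where
  field
    fun    : Loc → Maybe Loc
    finite : ∃ λ n → ∀ l → n ≤ l → fun l ≡ nothing
open Heap public

-- Split h h₁ h₂ : h = h₁ + h₂ with dom(h₁) ∩ dom(h₂) = ∅
Split : Heap → Heap → Heap → Set
Split h h₁ h₂ = ∀ l → (fun h₁ l ≡ nothing × fun h l ≡ fun h₂ l)
                    ⊎ (fun h₂ l ≡ nothing × fun h l ≡ fun h₁ l)

_,_⊨_ : Store → Heap → Form → Set
s , h ⊨ (x ≐ y) = s x ≡ s y
s , h ⊨ (x ↪ y) = fun h (s x) ≡ just (s y)
s , h ⊨ emp = ∀ l → fun h l ≡ nothing
s , h ⊨ (¬' φ) = ¬ (s , h ⊨ φ)
s , h ⊨ (φ ∧' ψ) = (s , h ⊨ φ) × (s , h ⊨ ψ)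
s , h ⊨ (φ ✶ ψ) = Σ Heap λ h₁ → Σ Heap λ h₂ →
                    Split h h₁ h₂ × (s , h₁ ⊨ φ) × (s , h₂ ⊨ ψ)
s , h ⊨ (φ −✶ ψ) = (h₁ h' : Heap) → Split h' h h₁ →
                    (s , h₁ ⊨ φ) → (s , h' ⊨ ψ)

Valid : Form → Set
Valid φ = (s : Store) (h : Heap) → s , h ⊨ φ

-- Boolean evaluation treating non-Boolean subformulae as atoms
evalB : (Form → Bool) → Form → Bool
evalB v (¬' φ) = not (evalB v φ)
evalB v (φ ∧' ψ) = evalB v φ ∧ evalB v ψ
evalB v φ = v φ

Taut : Form → Set
Taut φ = (v : Form → Bool) → evalB v φ ≡ true

-- renaming: replace every occurrence of y by x
renV : PVar → PVar → PVar → PVar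
renV y x z = if does (z ≟ y) then x else z

ren : PVar → PVar → Form → Form
ren y x (a ≐ b) = renV y x a ≐ renV y x b
ren y x (a ↪ b) = renV y x a ↪ renV y x b
ren y x emp = emp
ren y x (¬' φ) = ¬' ren y x φ
ren y x (φ ∧' ψ) = ren y x φ ∧' ren y x ψ
ren y x (φ ✶ ψ) = ren y x φ ✶ ren y x ψ
ren y x (φ −✶ ψ) = ren y x φ −✶ ren y x ψ

distinctAlloc : List PVar → Form
distinctAlloc X =
  Conj (map (λ x → alloc x ∧' Conj (map (λ y → ¬' (x ≐ y))
                                        (filter (λ y → ¬? (y ≟ x)) X))) X)

infix 2 ⊢C_
data ⊢C_ : Form → Set where
  taut : ∀ {φ} → Taut φ → ⊢C φ
  mp   : ∀ {φ ψ} → ⊢C φ → ⊢C (φ ⇒ ψ) → ⊢C ψ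
  ax1  : ∀ x → ⊢C (x ≐ x)
  ax2  : ∀ φ x y → ⊢C ((φ ∧' (x ≐ y)) ⇒ ren y x φ)
  ax3  : ∀ x y → ⊢C ((x ↪ y) ⇒ alloc x)
  ax4  : ∀ x y z → ⊢C (((x ↪ y) ∧' (x ↪ z)) ⇒ (y ≐ z))
  ax5  : ∀ β → ⊢C (size≥ (suc β) ⇒ size≥ β)
  -- X finite set of variables, given as a duplicate-free list, |X| = length X
  ax6  : ∀ (X : List PVar) → Unique X → ⊢C (distinctAlloc X ⇒ size≥ (length X))

IsCore : List PVar → ℕ → Form → Set
IsCore X α ψ =
    (∃ λ x → ∃ λ y → x ∈ X × y ∈ X × ψ ≡ (x ≐ y))
  ⊎ (∃ λ x → x ∈ X × ψ ≡ alloc x)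
  ⊎ (∃ λ x → ∃ λ y → x ∈ X × y ∈ X × ψ ≡ (x ↪ y))
  ⊎ (∃ λ β → β ≤ α × ψ ≡ size≥ β)

IsLiteral : List PVar → ℕ → Form → Set
IsLiteral X α φ = ∃ λ ψ → IsCore X α ψ × (φ ≡ ψ ⊎ φ ≡ ¬' ψ)

-- L (read as the conjunction Conj L) is a core type in Type(X, α)
IsCoreType : List PVar → ℕ → List Form → Set
IsCoreType X α L =
    (∀ φ → φ ∈ L → IsLiteral X α φ)
  × (∀ ψ → IsCore X α ψ →
        (ψ ∈ L × ¬ (¬' ψ ∈ L)) ⊎ (¬' ψ ∈ L × ¬ (ψ ∈ L)))

module Submission where

-- Soundness (⇐) holds for all formulae: every theorem of C is true in every
-- memory state, tautologies by Glivenko's argument (decide the finitely many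
-- atoms under a double negation).
--
-- Completeness (⇒) is constructive.  Derivability from the hypotheses L is
-- closed under tautological consequence and congruence.  A finite check either
-- derives a core formula whose negation lies in L, refuting L, or shows L
-- saturated: closed under the core instances of axioms (1)–(6); α ≥ |X| makes
-- the instance of (6) for one variable per allocated class a core formula.
-- A saturated core type has a model: variables sit at the index of their
-- L-equality class, allocated classes point as L says, and fresh cells pad
-- the heap to the largest size L asserts.  Validity of ¬L rules it out.

open import Defs
open import Function using (_∘_; id)
open import Data.Nat using (ℕ; zero; suc; _+_; _∸_; _≤_; _<_; _≟_; _<?_; _⊔_; z≤n; s≤s)
open import Data.Nat.Properties using (≤-refl; ≤-trans; <⇒≤; <-irrefl; <⇒≱; m≤n⇒m<n∨m≡n; m≤n⇒m≤1+n;
  m≤m+n; +-cancelˡ-≡; m+[n∸m]≡n; ≤-pred; suc-injective; n≤1+n; ≮⇒≥; <⇒≢; m⊔n≤o⇒m≤o; m⊔n≤o⇒n≤o)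
open import Data.Bool using (Bool; true; false; not; _∧_; if_then_else_)
open import Data.Maybe using (just; nothing)
open import Data.Maybe.Properties using (just-injective)
open import Data.List using (List; []; _∷_; _++_; map; length; filter; upTo; deduplicate)
open import Data.List.Properties using (length-++; length-upTo; length-map; length-filter; filter-notAll)
open import Data.List.Membership.Propositional using (_∈_; _∉_; find; lose)
open import Data.List.Membership.Propositional.Properties
  using (∈-filter⁺; ∈-filter⁻; ∈-upTo⁺; ∈-upTo⁻; ∈-++⁺ˡ; ∈-++⁺ʳ; ∈-++⁻; ∈-map⁺; ∈-map⁻)
open import Data.List.Relation.Binary.Subset.Propositional using (_⊆_)
open import Data.List.Relation.Unary.All as All using (All; []; _∷_)
import Data.List.Relation.Unary.All.Properties as All
import Data.List.Membership.DecPropositional as DecMembership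
open import Data.List.Relation.Unary.Any using (Any; here; there; any?)
import Data.List.Relation.Unary.Any.Properties as Any
import Data.List.Relation.Unary.Unique.DecSetoid.Properties as UniqueDS
open import Relation.Binary.Bundles using (DecSetoid)
import Relation.Binary.Construct.On as On
import Data.Nat.Properties as ℕ-Props
open import Data.List.Extrema.Nat using (max; xs≤max)
open import Data.List.Relation.Unary.AllPairs as AllPairs using (AllPairs; []; _∷_)
import Data.List.Relation.Unary.AllPairs.Properties as AllPairs
open import Data.List.Relation.Unary.Unique.Propositional using (Unique)
import Data.List.Relation.Unary.Unique.Propositional.Properties as Unique
open import Data.Product as Product using (∃; _×_; _,_; proj₁; proj₂)
open import Function.Bundles using (_⇔_; mk⇔; Equivalence)
open Equivalence using (to; from)
open import Data.Sum as Sum using (_⊎_; inj₁; inj₂)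
open import Data.Empty using (⊥; ⊥-elim)
open import Relation.Unary using (Decidable)
open import Relation.Binary using () renaming (Decidable to Decidable₂)
open import Level using (0ℓ)
open import Effect.Monad using (RawMonad)
import Data.Sum.Effectful.Left as SumLeft
open import Relation.Nullary using (¬_; Dec; yes; no; does; proof; map′; ¬?; _×-dec_)
open import Relation.Nullary.Decidable using (¬¬-excluded-middle)
open import Relation.Nullary.Reflects using (Reflects; ofʸ; ¬-reflects; _×-reflects_)
open import Relation.Binary.PropositionalEquality
  using (_≡_; _≢_; refl; sym; trans; cong; cong₂; subst; subst₂; module ≡-Reasoning)
open ≡-Reasoning

-- Formulae with different outermost
-- connectives are told apart by `shape`; this is what lets a valuation
-- be defined by table look-up in the Glivenko argument below.

shape : Form → ℕ
shape (_ ≐ _)  = 0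
shape (_ ↪ _)  = 1
shape emp      = 2
shape (¬' _)   = 3
shape (_ ∧' _) = 4
shape (_ ✶ _)  = 5
shape (_ −✶ _) = 6

infix 4 _≟F_

_≟F_ : (φ ψ : Form) → Dec (φ ≡ ψ)

private
  decide₂ : {A B : Set} {a a′ : A} {b b′ : B} {C : Set} (f : A → B → C) →
            (∀ {a a′ b b′} → f a b ≡ f a′ b′ → a ≡ a′ × b ≡ b′) →
            Dec (a ≡ a′) → Dec (b ≡ b′) → Dec (f a b ≡ f a′ b′)
  decide₂ f inj (yes refl) (yes refl) = yes refl
  decide₂ f inj (no a≢a′) _ = no λ eq → let (a≡a′ , _) = inj eq in a≢a′ a≡a′
  decide₂ f inj (yes _) (no b≢b′) = no λ eq → let (_ , b≡b′) = inj eq in b≢b′ b≡b′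

  sameShape : ∀ φ ψ → shape φ ≡ shape ψ → Dec (φ ≡ ψ)
  sameShape (a ≐ b)  (c ≐ d)  refl = decide₂ _≐_  (λ { refl → refl , refl }) (a ≟ c) (b ≟ d)
  sameShape (a ↪ b)  (c ↪ d)  refl = decide₂ _↪_  (λ { refl → refl , refl }) (a ≟ c) (b ≟ d)
  sameShape emp      emp      refl = yes refl
  sameShape (¬' φ)   (¬' ψ)   refl = map′ (cong ¬'_) (λ { refl → refl }) (φ ≟F ψ)
  sameShape (φ ∧' χ) (ψ ∧' ω) refl = decide₂ _∧'_ (λ { refl → refl , refl }) (φ ≟F ψ) (χ ≟F ω)
  sameShape (φ ✶ χ)  (ψ ✶ ω)  refl = decide₂ _✶_  (λ { refl → refl , refl }) (φ ≟F ψ) (χ ≟F ω)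
  sameShape (φ −✶ χ) (ψ −✶ ω) refl = decide₂ _−✶_ (λ { refl → refl , refl }) (φ ≟F ψ) (χ ≟F ω)

φ ≟F ψ with shape φ ≟ shape ψ
... | yes same = sameShape φ ψ same
... | no differ = no λ { refl → differ refl }

open DecMembership _≟F_ using () renaming (_∈?_ to _∈F?_)
open DecMembership _≟_ using () renaming (_∈?_ to _∈ℕ?_)

-- Propositional reasoning under a valuation.  `Holds v φ` says that φ is
-- true when its non-Boolean subformulae are read as atoms valued by v;
-- wrapping it in a record keeps φ recoverable by unification.

record Holds (v : Form → Bool) (φ : Form) : Set where
  constructor holds
  field holds-true : evalB v φ ≡ true
open Holds

private
  not-true : ∀ b → ¬ b ≡ true → not b ≡ true
  not-true true  b≢true = ⊥-elim (b≢true refl)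
  not-true false _      = refl

  not-elim : ∀ b → not b ≡ true → ¬ b ≡ true
  not-elim true () refl

  stable : ∀ b → ¬ ¬ b ≡ true → b ≡ true
  stable true  _ = refl
  stable false b≢≢true = ⊥-elim (b≢≢true λ ())

  ∧-true : ∀ a b → a ∧ b ≡ true → a ≡ true × b ≡ true
  ∧-true true b b≡true = refl , b≡true

module _ {v : Form → Bool} where

  ¬-intro : ∀ {φ} → ¬ Holds v φ → Holds v (¬' φ)
  ¬-intro {φ} ¬φ = holds (not-true (evalB v φ) (λ t → ¬φ (holds t)))

  ¬-elim : ∀ {φ} → Holds v (¬' φ) → ¬ Holds v φ
  ¬-elim {φ} (holds f) (holds t) = not-elim (evalB v φ) f t

  by-contradiction : ∀ {φ} → ¬ ¬ Holds v φ → Holds v φ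
  by-contradiction {φ} ¬¬φ = holds (stable (evalB v φ) λ ¬t → ¬¬φ λ h → ¬t (holds-true h))

  ∧-intro : ∀ {φ ψ} → Holds v φ → Holds v ψ → Holds v (φ ∧' ψ)
  ∧-intro (holds φ) (holds ψ) = holds (cong₂ _∧_ φ ψ)

  ∧-elimˡ : ∀ {φ ψ} → Holds v (φ ∧' ψ) → Holds v φ
  ∧-elimˡ {φ} {ψ} (holds φψ) = holds (proj₁ (∧-true (evalB v φ) (evalB v ψ) φψ))

  ∧-elimʳ : ∀ {φ ψ} → Holds v (φ ∧' ψ) → Holds v ψ
  ∧-elimʳ {φ} {ψ} (holds φψ) = holds (proj₂ (∧-true (evalB v φ) (evalB v ψ) φψ))

  ⇒-intro : ∀ {φ ψ} → (Holds v φ → Holds v ψ) → Holds v (φ ⇒ ψ)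
  ⇒-intro f = ¬-intro λ φ¬ψ → ¬-elim (∧-elimʳ φ¬ψ) (f (∧-elimˡ φ¬ψ))

  ⇒-elim : ∀ {φ ψ} → Holds v (φ ⇒ ψ) → Holds v φ → Holds v ψ
  ⇒-elim φ⇒ψ φ = by-contradiction λ ¬ψ → ¬-elim φ⇒ψ (∧-intro φ (¬-intro ¬ψ))

  Conj-holds : ∀ Ls {φ} → Holds v (Conj Ls) → φ ∈ Ls → Holds v φ
  Conj-holds (ψ ∷ [])     h (here refl) = h
  Conj-holds (ψ ∷ χ ∷ Ls) h (here refl) = ∧-elimˡ h
  Conj-holds (ψ ∷ χ ∷ Ls) h (there φ∈) = Conj-holds (χ ∷ Ls) (∧-elimʳ h) φ∈

tautology : ∀ {φ} → (∀ v → Holds v φ) → ⊢C φ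
tautology all-v = taut λ v → holds-true (all-v v)

record Der (L : List Form) (φ : Form) : Set where
  constructor der
  field derivation : ⊢C (Conj L ⇒ φ)

module _ {L : List Form} where

  Der-taut : ∀ {ψ} (Ps : List Form) → All (Der L) Ps →
             (∀ v → All (Holds v) Ps → Holds v ψ) → Der L ψ
  Der-taut [] [] f = der (tautology λ v → ⇒-intro λ _ → f v [])
  Der-taut {ψ} (P ∷ Ps) (der ⊢P ∷ ⊢Ps) f =
    der (mp ⊢P (mp ⊢P⇒ψ (tautology λ v →
      ⇒-intro λ P⇒ψ → ⇒-intro λ P → ⇒-intro λ c → ⇒-elim (⇒-elim P⇒ψ c) (⇒-elim P c))))
    where ⊢P⇒ψ : ⊢C (Conj L ⇒ (P ⇒ ψ))
          ⊢P⇒ψ = Der.derivation (Der-taut Ps ⊢Ps λ v hs → ⇒-intro λ p → f v (p ∷ hs))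

  Der-ax : ∀ {φ} → ⊢C φ → Der L φ
  Der-ax ⊢φ = der (mp ⊢φ (tautology λ v → ⇒-intro λ φ → ⇒-intro λ _ → φ))

  Der-mem : ∀ {φ} → φ ∈ L → Der L φ
  Der-mem φ∈L = der (tautology λ v → ⇒-intro λ c → Conj-holds L c φ∈L)

  Der-mp : ∀ {φ ψ} → Der L φ → Der L (φ ⇒ ψ) → Der L ψ
  Der-mp dφ dφ⇒ψ = Der-taut (_ ∷ _ ∷ []) (dφ ∷ dφ⇒ψ ∷ [])
    λ { v (φ ∷ φ⇒ψ ∷ []) → ⇒-elim φ⇒ψ φ }

  Der-∧ : ∀ {φ ψ} → Der L φ → Der L ψ → Der L (φ ∧' ψ)
  Der-∧ dφ dψ = Der-taut (_ ∷ _ ∷ []) (dφ ∷ dψ ∷ [])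
    λ { v (φ ∷ ψ ∷ []) → ∧-intro φ ψ }

  Der-⊤ : Der L ⊤'
  Der-⊤ = Der-taut (_ ∷ []) (Der-ax (ax1 0) ∷ [])
    λ { v (0≐0 ∷ []) → ¬-intro λ ¬0≐0 → ¬-elim ¬0≐0 0≐0 }

  Der-Conj : ∀ {Ls} → (∀ {φ} → φ ∈ Ls → Der L φ) → Der L (Conj Ls)
  Der-Conj {[]}         _   = Der-⊤
  Der-Conj {φ ∷ []}     all = all (here refl)
  Der-Conj {φ ∷ ψ ∷ Ls} all = Der-∧ (all (here refl)) (Der-Conj (all ∘ there))

  Der-refute : ∀ {φ} → Der L φ → Der L (¬' φ) → ⊢C ¬' Conj L
  Der-refute (der ⊢φ) (der ⊢¬φ) = mp ⊢¬φ (mp ⊢φ (tautology λ v →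
    ⇒-intro λ c⇒φ → ⇒-intro λ c⇒¬φ → ¬-intro λ c → ¬-elim (⇒-elim c⇒¬φ c) (⇒-elim c⇒φ c)))

  Der-cong : ∀ {a b φ ψ} → Der L (a ≐ b) → Der L φ → ren b a φ ≡ ren b a ψ → Der L ψ
  Der-cong {a} {b} {φ} {ψ} da≐b dφ same =
    Der-taut (_ ∷ _ ∷ _ ∷ _ ∷ []) (dφ ∷ da≐b ∷ ax2-φ ∷ Der-ax (ax2 (¬' ψ) a b) ∷ [])
      λ { v (φ ∷ a≐b ∷ φ⇒ρ ∷ ¬ψ⇒¬ρ ∷ []) → by-contradiction λ ¬ψ →
            ¬-elim (⇒-elim ¬ψ⇒¬ρ (∧-intro (¬-intro ¬ψ) a≐b)) (⇒-elim φ⇒ρ (∧-intro φ a≐b)) }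
    where ax2-φ : Der L ((φ ∧' (a ≐ b)) ⇒ ren b a ψ)
          ax2-φ = subst (λ ρ → Der L ((φ ∧' (a ≐ b)) ⇒ ρ)) same (Der-ax (ax2 φ a b))

renV-merges : ∀ y x → renV y x x ≡ renV y x y
renV-merges y x = trans (fixed (x ≟ y)) (sym (replaced (y ≟ y)))
  where fixed : (d : Dec (x ≡ y)) → (if does d then x else x) ≡ x
        fixed (yes _) = refl
        fixed (no _)  = refl
        replaced : (d : Dec (y ≡ y)) → (if does d then x else y) ≡ x
        replaced (yes _)  = refl
        replaced (no y≢y) = ⊥-elim (y≢y refl)

module _ {L : List Form} where

  Der-≐-sym : ∀ {x y} → Der L (x ≐ y) → Der L (y ≐ x)
  Der-≐-sym {x} {y} dx≐y =
    Der-cong dx≐y (Der-ax (ax1 x)) (cong (_≐ renV y x x) (renV-merges y x))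

  Der-≐-trans : ∀ {x y z} → Der L (x ≐ y) → Der L (y ≐ z) → Der L (x ≐ z)
  Der-≐-trans {x} {y} {z} dx≐y dy≐z =
    Der-cong dy≐z dx≐y (cong (renV z y x ≐_) (renV-merges z y))

  Der-alloc-cong : ∀ {x y} → Der L (x ≐ y) → Der L (alloc x) → Der L (alloc y)
  Der-alloc-cong {x} {y} dx≐y dx =
    Der-cong dx≐y dx (cong (λ w → (w ↪ w) −✶ ¬' (renV y x 0 ≐ renV y x 0)) (renV-merges y x))

  Der-↪-congˡ : ∀ {x x′ y} → Der L (x ≐ x′) → Der L (x ↪ y) → Der L (x′ ↪ y)
  Der-↪-congˡ {x} {x′} {y} dx≐x′ dx↪y =
    Der-cong dx≐x′ dx↪y (cong (_↪ renV x′ x y) (renV-merges x′ x))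

  Der-↪-congʳ : ∀ {x y y′} → Der L (y ≐ y′) → Der L (x ↪ y) → Der L (x ↪ y′)
  Der-↪-congʳ {x} {y} {y′} dy≐y′ dx↪y =
    Der-cong dy≐y′ dx↪y (cong (renV y′ y x ↪_) (renV-merges y′ y))

map-unique : ∀ {A B : Set} (f : A → B) {xs} → Unique xs →
             (∀ {x y} → x ∈ xs → y ∈ xs → x ≢ y → f x ≢ f y) → Unique (map f xs)
map-unique f [] _ = []
map-unique f (x∉xs ∷ xs-unique) separated =
  All.map⁺ (All.tabulate λ y∈ → separated (here refl) (there y∈) (All.lookup x∉xs y∈))
  ∷ map-unique f xs-unique λ x∈ y∈ → separated (there x∈) (there y∈)

length-deduplicate : ∀ {A : Set} {R : A → A → Set} (R? : Decidable₂ R) xs →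
                     length (deduplicate R? xs) ≤ length xs
length-deduplicate R? [] = z≤n
length-deduplicate R? (x ∷ xs) =
  s≤s (≤-trans (length-filter (¬? ∘ R? x) (deduplicate R? xs)) (length-deduplicate R? xs))

allPairs-lookup : ∀ {A : Set} {R : A → A → Set} → (∀ {a b} → R a b → R b a) →
                  ∀ {xs} → AllPairs R xs → ∀ {x y} → x ∈ xs → y ∈ xs → x ≢ y → R x y
allPairs-lookup R-sym (_ ∷ _)       (here refl) (here refl) x≢y = ⊥-elim (x≢y refl)
allPairs-lookup R-sym (x-R ∷ _)     (here refl) (there y∈)  _   = All.lookup x-R y∈
allPairs-lookup R-sym (y-R ∷ _)     (there x∈)  (here refl) _   = R-sym (All.lookup y-R x∈)
allPairs-lookup R-sym (_ ∷ rest-R)  (there x∈)  (there y∈)  x≢y = allPairs-lookup R-sym rest-R x∈ y∈ x≢y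

_∈dom_ : Loc → Heap → Set
l ∈dom h = fun h l ≢ nothing

_∈dom?_ : ∀ l h → Dec (l ∈dom h)
l ∈dom? h with fun h l
... | just _  = yes λ ()
... | nothing = no λ ¬nothing → ¬nothing refl

just≢nothing : ∀ {v : Loc} → just v ≢ nothing
just≢nothing ()

unallocated : ∀ h {l} → ¬ l ∈dom h → fun h l ≡ nothing
unallocated h {l} l∉ with fun h l
... | just _  = ⊥-elim (l∉ λ ())
... | nothing = refl

allocated-bound : ∀ {l h} → l ∈dom h → l < proj₁ (finite h)
allocated-bound {l} {h} l∈ with l <? proj₁ (finite h)
... | yes l<n = l<n
... | no  l≮n = ⊥-elim (l∈ (proj₂ (finite h) l (≮⇒≥ l≮n)))

split-domˡ : ∀ h h₁ h₂ {l} → Split h h₁ h₂ → l ∈dom h₁ →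
             fun h₂ l ≡ nothing × fun h l ≡ fun h₁ l
split-domˡ _ _ _ split l∈h₁ with split _
... | inj₁ (h₁l≡nothing , _) = ⊥-elim (l∈h₁ h₁l≡nothing)
... | inj₂ h₂-free           = h₂-free

split-domʳ : ∀ h h₁ h₂ {l} → Split h h₁ h₂ → l ∈dom h₂ →
             fun h₁ l ≡ nothing × fun h l ≡ fun h₂ l
split-domʳ h h₁ h₂ split = split-domˡ h h₂ h₁ (Sum.swap ∘ split)

domain : Heap → List Loc
domain h = filter (_∈dom? h) (upTo (proj₁ (finite h)))

domain-unique : ∀ h → Unique (domain h)
domain-unique h = Unique.filter⁺ (_∈dom? h) (Unique.upTo⁺ (proj₁ (finite h)))

domain-allocated : ∀ h → All (_∈dom h) (domain h)
domain-allocated h =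
  All.tabulate λ l∈ → proj₂ (∈-filter⁻ (_∈dom? h) {xs = upTo (proj₁ (finite h))} l∈)

domain-complete : ∀ h {l} → l ∈dom h → l ∈ domain h
domain-complete h l∈ = ∈-filter⁺ (_∈dom? h) (∈-upTo⁺ (allocated-bound {h = h} l∈)) l∈

restrict : ∀ {P : Loc → Set} → Decidable P → Heap → Heap
fun (restrict P? h) l with P? l
... | yes _ = fun h l
... | no  _ = nothing
finite (restrict P? h) = let (n , beyond) = finite h in n , λ l n≤l → restricted l (beyond l n≤l)
  where restricted : ∀ l → fun h l ≡ nothing → fun (restrict P? h) l ≡ nothing
        restricted l h-free with P? l
        ... | yes _ = h-free
        ... | no  _ = refl

restrict-split : ∀ {P : Loc → Set} (P? : Decidable P) h →
                 Split h (restrict P? h) (restrict (¬? ∘ P?) h)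
restrict-split P? h l with P? l
... | yes _ = inj₂ (refl , refl)
... | no  _ = inj₁ (refl , refl)

restrict-keeps : ∀ {P : Loc → Set} (P? : Decidable P) h {l} → P l →
                 fun (restrict P? h) l ≡ fun h l
restrict-keeps P? h {l} Pl with P? l
... | yes _  = refl
... | no ¬Pl = ⊥-elim (¬Pl Pl)

emptyHeap : Heap
fun emptyHeap _ = nothing
finite emptyHeap = 0 , λ _ _ → refl

_[_↦_] : Heap → Loc → Loc → Heap
fun (h [ a ↦ v ]) l with l ≟ a
... | yes _ = just v
... | no  _ = fun h l
finite (h [ a ↦ v ]) = let (n , beyond) = finite h in n ⊔ suc a , λ l n⊔a<l →
  updated l (<⇒≢ (m⊔n≤o⇒n≤o n (suc a) n⊔a<l) ∘ sym) (beyond l (m⊔n≤o⇒m≤o n (suc a) n⊔a<l))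
  where updated : ∀ l → l ≢ a → fun h l ≡ nothing → fun (h [ a ↦ v ]) l ≡ nothing
        updated l l≢a h-free with l ≟ a
        ... | yes l≡a = ⊥-elim (l≢a l≡a)
        ... | no  _   = h-free

update-here : ∀ h a v → fun (h [ a ↦ v ]) a ≡ just v
update-here h a v with a ≟ a
... | yes _   = refl
... | no a≢a = ⊥-elim (a≢a refl)

update-split : ∀ h a v → fun h a ≡ nothing → Split (h [ a ↦ v ]) h (emptyHeap [ a ↦ v ])
update-split h a v h-free l with l ≟ a
... | yes refl = inj₁ (h-free , refl)
... | no  _    = inj₂ (refl , refl)

finiteMap : List Loc → (Loc → Loc) → Heap
fun (finiteMap D f) l with l ∈ℕ? D
... | yes _ = just (f l)
... | no  _ = nothing
finite (finiteMap D f) = suc (max 0 D) , λ l max<l → outside l λ l∈D →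
  <-irrefl refl (≤-trans (s≤s (All.lookup (xs≤max 0 D) l∈D)) max<l)
  where outside : ∀ l → l ∉ D → fun (finiteMap D f) l ≡ nothing
        outside l l∉D with l ∈ℕ? D
        ... | yes l∈D = ⊥-elim (l∉D l∈D)
        ... | no  _   = refl

finiteMap-in : ∀ {D f l} → l ∈ D → fun (finiteMap D f) l ≡ just (f l)
finiteMap-in {D} {f} {l} l∈D with l ∈ℕ? D
... | yes _   = refl
... | no l∉D = ⊥-elim (l∉D l∈D)

finiteMap-dom : ∀ {D f l} → l ∈dom finiteMap D f → l ∈ D
finiteMap-dom {D} {f} {l} l∈ with l ∈ℕ? D
... | yes l∈D = l∈D
... | no  _   = ⊥-elim (l∈ refl)

module _ (s : Store) where

  nonempty-witness : ∀ h D → (∀ {l} → l ∈dom h → l ∈ D) → ¬ (s , h ⊨ emp) →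
                     ∃ λ a → a ∈ D × a ∈dom h
  nonempty-witness h D dom⊆D nonempty with any? (_∈dom? h) D
  ... | yes some = find some
  ... | no none  = ⊥-elim (nonempty λ l → unallocated h λ l∈ → none (lose (dom⊆D l∈) l∈))

  size≥-intro : ∀ β h D → Unique D → All (_∈dom h) D → β ≤ length D → s , h ⊨ size≥ β
  size≥-intro zero h D _ _ _ = λ ¬refl → ¬refl refl
  size≥-intro (suc zero) h (a ∷ D) _ (a∈ ∷ _) _ = λ empty → a∈ (empty a)
  size≥-intro (suc (suc β)) h (a ∷ D) (a∉D ∷ D-unique) (a∈ ∷ D∈) (s≤s β≤D) =
    restrict (_≟ a) h , restrict (¬? ∘ (_≟ a)) h , restrict-split (_≟ a) h ,
    (λ empty → a∈ (trans (sym (restrict-keeps (_≟ a) h refl)) (empty a))) ,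
    size≥-intro (suc β) _ D D-unique (All.zipWith still-allocated (a∉D , D∈)) β≤D
    where still-allocated : ∀ {l} → a ≢ l × l ∈dom h → l ∈dom restrict (¬? ∘ (_≟ a)) h
          still-allocated (a≢l , l∈) = subst (_≢ nothing)
            (sym (restrict-keeps (¬? ∘ (_≟ a)) h (a≢l ∘ sym))) l∈

  size≥-elim : ∀ β h D → (∀ {l} → l ∈dom h → l ∈ D) → s , h ⊨ size≥ β → β ≤ length D
  size≥-elim zero h D _ _ = z≤n
  size≥-elim (suc zero) h D dom⊆D nonempty with nonempty-witness h D dom⊆D nonempty
  ... | _ , here _ , _ = s≤s z≤n
  ... | _ , there _ , _ = s≤s z≤n
  size≥-elim (suc (suc β)) h D dom⊆D (h₁ , h₂ , split , nonempty , h₂-size) =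
    let (a , a∈D , a∈h₁) = nonempty-witness h₁ D (dom⊆D ∘ h₁⊆h) nonempty
        D-a = filter (¬? ∘ (_≟ a)) D
        h₂⊆D-a : ∀ {l} → l ∈dom h₂ → l ∈ D-a
        h₂⊆D-a {l} l∈ = ∈-filter⁺ (¬? ∘ (_≟ a))
          (dom⊆D (subst (_≢ nothing) (sym (proj₂ (split-domʳ h h₁ h₂ split l∈))) l∈))
          λ { refl → l∈ (proj₁ (split-domˡ h h₁ h₂ split a∈h₁)) }
    in ≤-trans (s≤s (size≥-elim (suc β) h₂ D-a h₂⊆D-a h₂-size))
               (filter-notAll (¬? ∘ (_≟ a)) D (lose a∈D λ a≢a → a≢a refl))
    where h₁⊆h : ∀ {l} → l ∈dom h₁ → l ∈dom h
          h₁⊆h l∈ = subst (_≢ nothing) (sym (proj₂ (split-domˡ h h₁ h₂ split l∈))) l∈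

  size≥-iff : ∀ β h → (s , h ⊨ size≥ β) ⇔ (β ≤ length (domain h))
  size≥-iff β h = mk⇔ (size≥-elim β h (domain h) (domain-complete h))
                      (size≥-intro β h (domain h) (domain-unique h) (domain-allocated h))

  size≥-down : ∀ β h → s , h ⊨ size≥ (suc β) → s , h ⊨ size≥ β
  size≥-down β h = from (size≥-iff β h) ∘ ≤-trans (n≤1+n β) ∘ to (size≥-iff (suc β) h)

  alloc-intro : ∀ h x → s x ∈dom h → s , h ⊨ alloc x
  alloc-intro h x sx∈ h₁ h′ split x↪x _ with split (s x)
  ... | inj₁ (h-free , _)  = sx∈ h-free
  ... | inj₂ (h₁-free , _) = just≢nothing (trans (sym x↪x) h₁-free)

  alloc-elim : ∀ h x → s , h ⊨ alloc x → s x ∈dom h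
  alloc-elim h x allocated h-free =
    allocated (emptyHeap [ s x ↦ s x ]) (h [ s x ↦ s x ]) (update-split h (s x) (s x) h-free)
              (update-here emptyHeap (s x) (s x)) refl

  Conj-elim : ∀ h Ls → s , h ⊨ Conj Ls → All (s , h ⊨_) Ls
  Conj-elim h [] _ = []
  Conj-elim h (φ ∷ []) sat = sat ∷ []
  Conj-elim h (φ ∷ ψ ∷ Ls) (φ-sat , rest) = φ-sat ∷ Conj-elim h (ψ ∷ Ls) rest

  Conj-intro : ∀ h Ls → All (s , h ⊨_) Ls → s , h ⊨ Conj Ls
  Conj-intro h [] [] = λ ¬refl → ¬refl refl
  Conj-intro h (φ ∷ []) (φ-sat ∷ []) = φ-sat
  Conj-intro h (φ ∷ ψ ∷ Ls) (φ-sat ∷ rest) = φ-sat , Conj-intro h (ψ ∷ Ls) rest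

  distinctAlloc-sound : ∀ h X → Unique X → s , h ⊨ distinctAlloc X → s , h ⊨ size≥ (length X)
  distinctAlloc-sound h X X-unique sat = subst (λ n → s , h ⊨ size≥ n) (length-map s X)
    (size≥-intro (length (map s X)) h (map s X) (map-unique s X-unique separated)
      (All.map⁺ (All.map (alloc-elim h _ ∘ proj₁) clauses)) ≤-refl)
    where
      others : PVar → List PVar
      others x = filter (λ y → ¬? (y ≟ x)) X
      clause : PVar → Form
      clause x = alloc x ∧' Conj (map (λ y → ¬' (x ≐ y)) (others x))
      clauses : All (λ x → s , h ⊨ clause x) X
      clauses = All.map⁻ (Conj-elim h (map clause X) sat)
      separated : ∀ {x y} → x ∈ X → y ∈ X → x ≢ y → s x ≢ s y
      separated {x} x∈ y∈ x≢y =
        All.lookup (All.map⁻ (Conj-elim h _ (proj₂ (All.lookup clauses x∈))))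
                   (∈-filter⁺ (λ y → ¬? (y ≟ x)) y∈ (x≢y ∘ sym))

module _ (s : Store) {y x : PVar} (same : ∀ z → s (renV y x z) ≡ s z) where

  ren-sem : ∀ φ h → (s , h ⊨ ren y x φ) ⇔ (s , h ⊨ φ)
  ren-sem (a ≐ b) h = mk⇔ (λ e → trans (sym (same a)) (trans e (same b)))
                          (λ e → trans (same a) (trans e (sym (same b))))
  ren-sem (a ↪ b) h = mk⇔ (subst₂ (λ l v → fun h l ≡ just v) (same a) (same b))
                          (subst₂ (λ l v → fun h l ≡ just v) (sym (same a)) (sym (same b)))
  ren-sem emp h = mk⇔ id id
  ren-sem (¬' φ) h = mk⇔ (λ ¬ρ φ-sat → ¬ρ (from (ren-sem φ h) φ-sat))
                         (λ ¬φ ρ-sat → ¬φ (to (ren-sem φ h) ρ-sat))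
  ren-sem (φ ∧' ψ) h = mk⇔ (Product.map (to (ren-sem φ h)) (to (ren-sem ψ h)))
                           (Product.map (from (ren-sem φ h)) (from (ren-sem ψ h)))
  ren-sem (φ ✶ ψ) h =
    mk⇔ (λ (h₁ , h₂ , split , sat₁ , sat₂) →
           h₁ , h₂ , split , to (ren-sem φ h₁) sat₁ , to (ren-sem ψ h₂) sat₂)
        (λ (h₁ , h₂ , split , sat₁ , sat₂) →
           h₁ , h₂ , split , from (ren-sem φ h₁) sat₁ , from (ren-sem ψ h₂) sat₂)
  ren-sem (φ −✶ ψ) h =
    mk⇔ (λ wand h₁ h′ split sat₁ → to (ren-sem ψ h′) (wand h₁ h′ split (from (ren-sem φ h₁) sat₁)))
        (λ wand h₁ h′ split sat₁ → from (ren-sem ψ h′) (wand h₁ h′ split (to (ren-sem φ h₁) sat₁)))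

renaming-invisible : ∀ (s : Store) {y x} → s x ≡ s y → ∀ z → s (renV y x z) ≡ s z
renaming-invisible s {y} {x} sx≡sy z = invisible (z ≟ y)
  where invisible : (d : Dec (z ≡ y)) → s (if does d then x else z) ≡ s z
        invisible (yes refl) = sx≡sy
        invisible (no _)     = refl

-- Glivenko's argument for tautologies: at a fixed memory state, decide
-- (under a double negation) the finitely many non-Boolean subformulae of
-- φ; the valuation reading off those decisions evaluates φ to its truth.
atoms : Form → List Form
atoms (¬' φ)   = atoms φ
atoms (φ ∧' ψ) = atoms φ ++ atoms ψ
atoms φ        = φ ∷ []

module Glivenko (s : Store) (h : Heap) where

  private
    Decisions : List Form → Set
    Decisions = All (λ a → Dec (s , h ⊨ a))

  ¬¬-decisions : ∀ as → ¬ ¬ Decisions as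
  ¬¬-decisions []       have = have []
  ¬¬-decisions (a ∷ as) have =
    ¬¬-excluded-middle λ a? → ¬¬-decisions as λ as? → have (a? ∷ as?)

  module _ {as : List Form} (decisions : Decisions as) where

    valuation : Form → Bool
    valuation a with a ∈F? as
    ... | yes a∈ = does (All.lookup decisions a∈)
    ... | no  _  = false

    valuation-atom : ∀ {a} → a ∈ as → Reflects (s , h ⊨ a) (valuation a)
    valuation-atom {a} a∈ with a ∈F? as
    ... | yes a∈′ = proof (All.lookup decisions a∈′)
    ... | no  a∉  = ⊥-elim (a∉ a∈)

    evalB-reflects : ∀ φ → atoms φ ⊆ as → Reflects (s , h ⊨ φ) (evalB valuation φ)
    evalB-reflects (¬' φ)   sub = ¬-reflects (evalB-reflects φ sub)
    evalB-reflects (φ ∧' ψ) sub = evalB-reflects φ (sub ∘ ∈-++⁺ˡ)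
                                  ×-reflects evalB-reflects ψ (sub ∘ ∈-++⁺ʳ (atoms φ))
    evalB-reflects (_ ≐ _)  sub = valuation-atom (sub (here refl))
    evalB-reflects (_ ↪ _)  sub = valuation-atom (sub (here refl))
    evalB-reflects emp      sub = valuation-atom (sub (here refl))
    evalB-reflects (_ ✶ _)  sub = valuation-atom (sub (here refl))
    evalB-reflects (_ −✶ _) sub = valuation-atom (sub (here refl))

  tautology-sound : ∀ {φ} → Taut φ → ¬ ¬ (s , h ⊨ φ)
  tautology-sound {φ} tautological refuted = ¬¬-decisions (atoms φ) λ decisions →
    refuted (reflects-true (evalB-reflects decisions φ id) (tautological (valuation decisions)))
    where reflects-true : ∀ {A : Set} {b} → Reflects A b → b ≡ true → A
          reflects-true (ofʸ a) _ = a

sound : ∀ {φ} → ⊢C φ → ∀ s h → ¬ ¬ (s , h ⊨ φ)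
sound (taut tautological) s h = Glivenko.tautology-sound s h tautological
sound (mp ⊢φ ⊢φ⇒ψ) s h ¬ψ = sound ⊢φ s h λ φ → sound ⊢φ⇒ψ s h λ φ⇒ψ → φ⇒ψ (φ , ¬ψ)
sound (ax1 x) s h refuted = refuted refl
sound (ax2 φ x y) s h refuted =
  refuted λ ((φ-sat , x≡y) , ¬ρ) → ¬ρ (from (ren-sem s (renaming-invisible s x≡y) φ h) φ-sat)
sound (ax3 x y) s h refuted = refuted λ (x↪y , ¬alloc) →
  ¬alloc (alloc-intro s h x λ x-free → just≢nothing (trans (sym x↪y) x-free))
sound (ax4 x y z) s h refuted =
  refuted λ ((x↪y , x↪z) , y≢z) → y≢z (just-injective (trans (sym x↪y) x↪z))
sound (ax5 β) s h refuted = refuted λ (bigger , ¬smaller) → ¬smaller (size≥-down s β h bigger)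
sound (ax6 X X-unique) s h refuted =
  refuted λ (distinct , ¬size) → ¬size (distinctAlloc-sound s h X X-unique distinct)

refutation-sound : ∀ {φ} → ⊢C ¬' φ → Valid (¬' φ)
refutation-sound ⊢¬φ s h φ-sat = sound ⊢¬φ s h λ ¬φ → ¬φ φ-sat

-- Either L is
-- refuted by C, or L is saturated: closed under the core consequences of
-- axioms (1)–(6).
module Completeness (X : List PVar) (α : ℕ) (X≤α : length X ≤ α)
                    (L : List Form) (core-type : IsCoreType X α L) where

  Refuted : Set
  Refuted = ⊢C ¬' Conj L

  open RawMonad (SumLeft.monad Refuted 0ℓ) using (pure; _>>=_)

  ≐-core : ∀ {x y} → x ∈ X → y ∈ X → IsCore X α (x ≐ y)
  ≐-core x∈ y∈ = inj₁ (_ , _ , x∈ , y∈ , refl)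

  alloc-core : ∀ {x} → x ∈ X → IsCore X α (alloc x)
  alloc-core x∈ = inj₂ (inj₁ (_ , x∈ , refl))

  ↪-core : ∀ {x y} → x ∈ X → y ∈ X → IsCore X α (x ↪ y)
  ↪-core x∈ y∈ = inj₂ (inj₂ (inj₁ (_ , _ , x∈ , y∈ , refl)))

  size-core : ∀ {β} → β ≤ α → IsCore X α (size≥ β)
  size-core β≤α = inj₂ (inj₂ (inj₂ (_ , β≤α , refl)))

  negation-in : ∀ {ψ} → IsCore X α ψ → ψ ∉ L → ¬' ψ ∈ L
  negation-in {ψ} core ψ∉ with proj₂ core-type ψ core
  ... | inj₁ (ψ∈ , _) = ⊥-elim (ψ∉ ψ∈)
  ... | inj₂ (¬ψ∈ , _) = ¬ψ∈

  not-both : ∀ {ψ} → IsCore X α ψ → ψ ∈ L → ¬' ψ ∈ L → ⊥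
  not-both {ψ} core ψ∈ ¬ψ∈ with proj₂ core-type ψ core
  ... | inj₁ (_ , ¬ψ∉) = ¬ψ∉ ¬ψ∈
  ... | inj₂ (_ , ψ∉)  = ψ∉ ψ∈

  settle : ∀ {ψ} → IsCore X α ψ → Der L ψ → Refuted ⊎ ψ ∈ L
  settle {ψ} core ⊢ψ with ψ ∈F? L
  ... | yes ψ∈ = inj₂ ψ∈
  ... | no  ψ∉ = inj₁ (Der-refute ⊢ψ (Der-mem (negation-in core ψ∉)))

  forall∈ : ∀ {A : Set} {Q : A → Set} (as : List A) →
            (∀ {a} → a ∈ as → Refuted ⊎ Q a) → Refuted ⊎ (∀ {a} → a ∈ as → Q a)
  forall∈ [] _ = pure λ ()
  forall∈ (a ∷ as) check = do
    Qa  ← check (here refl)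
    Qas ← forall∈ as (check ∘ there)
    pure λ { (here refl) → Qa ; (there a∈) → Qas a∈ }

  whenever : ∀ φ {Q : Set} → (φ ∈ L → Refuted ⊎ Q) → Refuted ⊎ (φ ∈ L → Q)
  whenever φ check with φ ∈F? L
  ... | yes φ∈ = Sum.map₂ (λ q _ → q) (check φ∈)
  ... | no  φ∉ = pure λ φ∈ → ⊥-elim (φ∉ φ∈)

  record EqClosed : Set where
    field
      ≐-refl  : ∀ {x} → x ∈ X → (x ≐ x) ∈ L
      ≐-sym   : ∀ {x} → x ∈ X → ∀ {y} → y ∈ X → (x ≐ y) ∈ L → (y ≐ x) ∈ L
      ≐-trans : ∀ {x} → x ∈ X → ∀ {y} → y ∈ X → ∀ {z} → z ∈ X →
                (x ≐ y) ∈ L → (y ≐ z) ∈ L → (x ≐ z) ∈ L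

  check-EqClosed : Refuted ⊎ EqClosed
  check-EqClosed = do
    refl′  ← forall∈ X λ {x} x∈ → settle (≐-core x∈ x∈) (Der-ax (ax1 x))
    sym′   ← forall∈ X λ x∈ → forall∈ X λ y∈ → whenever _ λ x≐y →
               settle (≐-core y∈ x∈) (Der-≐-sym (Der-mem x≐y))
    trans′ ← forall∈ X λ x∈ → forall∈ X λ y∈ → forall∈ X λ z∈ →
               whenever _ λ x≐y → whenever _ λ y≐z →
               settle (≐-core x∈ z∈) (Der-≐-trans (Der-mem x≐y) (Der-mem y≐z))
    pure record { ≐-refl = refl′ ; ≐-sym = sym′ ; ≐-trans = trans′ }

  classIndex : PVar → List PVar → ℕ
  classIndex z [] = 0
  classIndex z (w ∷ ws) with (z ≐ w) ∈F? L
  ... | yes _ = 0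
  ... | no  _ = suc (classIndex z ws)

  store : Store
  store z = classIndex z X

  classIndex-meet : ∀ {x y} ws → classIndex x ws ≡ classIndex y ws →
                    classIndex x ws < length ws →
                    ∃ λ w → w ∈ ws × (x ≐ w) ∈ L × (y ≐ w) ∈ L
  classIndex-meet {x} {y} (w ∷ ws) same below with (x ≐ w) ∈F? L | (y ≐ w) ∈F? L
  ... | yes x≐w | yes y≐w = w , here refl , x≐w , y≐w
  ... | no  _   | no  _   =
    let (v , v∈ , x≐v , y≐v) = classIndex-meet ws (suc-injective same) (≤-pred below)
    in v , there v∈ , x≐v , y≐v

  -- The variables of X that L allocates, and Y: one of them from each
  -- store class.  Axiom (6) applied to Y yields the lower size bound.
  allocatedVars : List PVar
  allocatedVars = filter (λ x → alloc x ∈F? L) X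

  storeClasses : DecSetoid 0ℓ 0ℓ
  storeClasses = On.decSetoid ℕ-Props.≡-decSetoid store

  Y : List PVar
  Y = deduplicate (DecSetoid._≟_ storeClasses) allocatedVars

  Y-separated : AllPairs (λ x y → store x ≢ store y) Y
  Y-separated = UniqueDS.deduplicate-! storeClasses allocatedVars

  Y-unique : Unique Y
  Y-unique = AllPairs.map (λ sx≢sy x≡y → sx≢sy (cong store x≡y)) Y-separated

  Y≤α : length Y ≤ α
  Y≤α = ≤-trans (length-deduplicate _ allocatedVars)
                (≤-trans (length-filter (λ x → alloc x ∈F? L) X) X≤α)

  Y-allocated : ∀ {y} → y ∈ Y → y ∈ X × alloc y ∈ L
  Y-allocated y∈ =
    ∈-filter⁻ (λ x → alloc x ∈F? L) (Any.deduplicate⁻ (DecSetoid._≟_ storeClasses) y∈)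

  Y-covers : ∀ {x} → x ∈ X → alloc x ∈ L → ∃ λ y → y ∈ Y × store y ≡ store x
  Y-covers {x} x∈ allocated = find (Any.deduplicate⁺ (DecSetoid._≟_ storeClasses)
    {P = λ y → store y ≡ store x} (λ sb≡sa sa≡sx → trans sb≡sa sa≡sx)
    (lose (∈-filter⁺ (λ x → alloc x ∈F? L) x∈ allocated) refl))

  Y-apart : ∀ {x y} → x ∈ Y → y ∈ Y → x ≢ y → store x ≢ store y
  Y-apart = allPairs-lookup (_∘ sym) Y-separated

  module Classes (E : EqClosed) where
    open EqClosed E

    classIndex-bound : ∀ {z} ws → Any (λ w → (z ≐ w) ∈ L) ws → classIndex z ws < length ws
    classIndex-bound {z} (w ∷ ws) some with (z ≐ w) ∈F? L
    ... | yes _ = s≤s z≤n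
    ... | no z≉w with some
    ...   | here z≐w   = ⊥-elim (z≉w z≐w)
    ...   | there rest = s≤s (classIndex-bound ws rest)

    classIndex-≐ : ∀ {x y} → x ∈ X → y ∈ X → (x ≐ y) ∈ L →
                   ∀ ws → ws ⊆ X → classIndex x ws ≡ classIndex y ws
    classIndex-≐ x∈ y∈ x≐y [] _ = refl
    classIndex-≐ {x} {y} x∈ y∈ x≐y (w ∷ ws) ws⊆X with (x ≐ w) ∈F? L | (y ≐ w) ∈F? L
    ... | yes _   | yes _   = refl
    ... | no  _   | no  _   = cong suc (classIndex-≐ x∈ y∈ x≐y ws (ws⊆X ∘ there))
    ... | yes x≐w | no  y≉w = ⊥-elim (y≉w (≐-trans y∈ x∈ (ws⊆X (here refl)) (≐-sym x∈ y∈ x≐y) x≐w))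
    ... | no  x≉w | yes y≐w = ⊥-elim (x≉w (≐-trans x∈ y∈ (ws⊆X (here refl)) x≐y y≐w))

    store-bound : ∀ {x} → x ∈ X → store x < length X
    store-bound x∈ = classIndex-bound X (lose x∈ (≐-refl x∈))

    store-sound : ∀ {x y} → x ∈ X → y ∈ X → (x ≐ y) ∈ L → store x ≡ store y
    store-sound x∈ y∈ x≐y = classIndex-≐ x∈ y∈ x≐y X id

    store-complete : ∀ {x y} → x ∈ X → y ∈ X → store x ≡ store y → (x ≐ y) ∈ L
    store-complete x∈ y∈ same =
      let (w , w∈ , x≐w , y≐w) = classIndex-meet X same (store-bound x∈)
      in ≐-trans x∈ w∈ y∈ x≐w (≐-sym y∈ w∈ y≐w)

    Der-distinctAlloc : Der L (distinctAlloc Y)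
    Der-distinctAlloc = Der-Conj λ φ∈ → clause (∈-map⁻ _ φ∈)
      where
        clause : ∀ {φ} → (∃ λ x → x ∈ Y × φ ≡ (alloc x ∧' Conj (map (λ y → ¬' (x ≐ y))
                                                    (filter (λ y → ¬? (y ≟ x)) Y)))) → Der L φ
        clause (x , x∈ , refl) =
          Der-∧ (Der-mem (proj₂ (Y-allocated x∈))) (Der-Conj λ ψ∈ → unequal (∈-map⁻ _ ψ∈))
          where
            unequal : ∀ {ψ} → (∃ λ y → y ∈ filter (λ y → ¬? (y ≟ x)) Y × ψ ≡ ¬' (x ≐ y)) → Der L ψ
            unequal (y , y∈′ , refl) =
              let (y∈ , y≢x) = ∈-filter⁻ (λ y → ¬? (y ≟ x)) {xs = Y} y∈′
                  x∈X = proj₁ (Y-allocated x∈)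
                  y∈X = proj₁ (Y-allocated y∈)
              in Der-mem (negation-in (≐-core x∈X y∈X)
                   λ x≐y → Y-apart x∈ y∈ (y≢x ∘ sym) (store-sound x∈X y∈X x≐y))

  record Saturated : Set where
    field
      eq-closed    : EqClosed
      alloc-cong   : ∀ {x} → x ∈ X → ∀ {y} → y ∈ X → (x ≐ y) ∈ L → alloc x ∈ L → alloc y ∈ L
      ↪-congˡ      : ∀ {x} → x ∈ X → ∀ {x′} → x′ ∈ X → ∀ {y} → y ∈ X →
                     (x ≐ x′) ∈ L → (x ↪ y) ∈ L → (x′ ↪ y) ∈ L
      ↪-congʳ      : ∀ {x} → x ∈ X → ∀ {y} → y ∈ X → ∀ {y′} → y′ ∈ X →
                     (y ≐ y′) ∈ L → (x ↪ y) ∈ L → (x ↪ y′) ∈ L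
      ↪-alloc      : ∀ {x} → x ∈ X → ∀ {y} → y ∈ X → (x ↪ y) ∈ L → alloc x ∈ L
      ↪-functional : ∀ {x} → x ∈ X → ∀ {y} → y ∈ X → ∀ {z} → z ∈ X →
                     (x ↪ y) ∈ L → (x ↪ z) ∈ L → (y ≐ z) ∈ L
      size-zero    : size≥ 0 ∈ L
      size-down    : ∀ {β} → β ∈ upTo α → size≥ (suc β) ∈ L → size≥ β ∈ L
      size-classes : size≥ (length Y) ∈ L
    open EqClosed eq-closed public

  check-Saturated : Refuted ⊎ Saturated
  check-Saturated = do
    E ← check-EqClosed
    alloc-cong′ ← forall∈ X λ x∈ → forall∈ X λ y∈ →
      whenever _ λ x≐y → whenever _ λ x-alloc →
      settle (alloc-core y∈) (Der-alloc-cong (Der-mem x≐y) (Der-mem x-alloc))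
    ↪-congˡ′ ← forall∈ X λ x∈ → forall∈ X λ x′∈ → forall∈ X λ y∈ →
      whenever _ λ x≐x′ → whenever _ λ x↪y →
      settle (↪-core x′∈ y∈) (Der-↪-congˡ (Der-mem x≐x′) (Der-mem x↪y))
    ↪-congʳ′ ← forall∈ X λ x∈ → forall∈ X λ y∈ → forall∈ X λ y′∈ →
      whenever _ λ y≐y′ → whenever _ λ x↪y →
      settle (↪-core x∈ y′∈) (Der-↪-congʳ (Der-mem y≐y′) (Der-mem x↪y))
    ↪-alloc′ ← forall∈ X λ {x} x∈ → forall∈ X λ {y} y∈ → whenever _ λ x↪y →
      settle (alloc-core x∈) (Der-mp (Der-mem x↪y) (Der-ax (ax3 x y)))
    ↪-functional′ ← forall∈ X λ {x} x∈ → forall∈ X λ {y} y∈ → forall∈ X λ {z} z∈ →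
      whenever _ λ x↪y → whenever _ λ x↪z →
      settle (≐-core y∈ z∈) (Der-mp (Der-∧ (Der-mem x↪y) (Der-mem x↪z)) (Der-ax (ax4 x y z)))
    size-zero′ ← settle (size-core z≤n) Der-⊤
    size-down′ ← forall∈ (upTo α) λ {β} β∈ → whenever _ λ bigger →
      settle (size-core (<⇒≤ (∈-upTo⁻ β∈))) (Der-mp (Der-mem bigger) (Der-ax (ax5 β)))
    size-classes′ ← settle (size-core Y≤α)
      (Der-mp (Classes.Der-distinctAlloc E) (Der-ax (ax6 Y Y-unique)))
    pure record
      { eq-closed = E ; alloc-cong = alloc-cong′ ; ↪-congˡ = ↪-congˡ′ ; ↪-congʳ = ↪-congʳ′
      ; ↪-alloc = ↪-alloc′ ; ↪-functional = ↪-functional′ ; size-zero = size-zero′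
      ; size-down = size-down′ ; size-classes = size-classes′ }

  -- Variables are placed at their
  -- class indices (all below N = |X|); the cells are the locations of the
  -- allocated classes, each pointing to the class its variables point to
  -- in L (or to the unused location N), padded with fresh cells from N on
  -- up to the largest size n that L asserts.
  module Model (S : Saturated) where
    open Saturated S
    open Classes eq-closed

    N : ℕ
    N = length X

    size-downward : ∀ {β} m → β ≤ m → m ≤ α → size≥ m ∈ L → size≥ β ∈ L
    size-downward zero z≤n _ = id
    size-downward (suc m) β≤1+m 1+m≤α with m≤n⇒m<n∨m≡n β≤1+m
    ... | inj₂ refl = id
    ... | inj₁ β<1+m = size-downward m (≤-pred β<1+m) (<⇒≤ 1+m≤α) ∘ size-down (∈-upTo⁺ 1+m≤α)

    largest : ℕ → ℕ
    largest zero = zero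
    largest (suc b) with size≥ (suc b) ∈F? L
    ... | yes _ = suc b
    ... | no  _ = largest b

    largest-≤ : ∀ b → largest b ≤ b
    largest-≤ zero = z≤n
    largest-≤ (suc b) with size≥ (suc b) ∈F? L
    ... | yes _ = ≤-refl
    ... | no  _ = m≤n⇒m≤1+n (largest-≤ b)

    largest-in : ∀ b → size≥ (largest b) ∈ L
    largest-in zero = size-zero
    largest-in (suc b) with size≥ (suc b) ∈F? L
    ... | yes in-L = in-L
    ... | no  _    = largest-in b

    largest-max : ∀ b {β} → β ≤ b → size≥ β ∈ L → β ≤ largest b
    largest-max zero β≤0 _ = β≤0
    largest-max (suc b) β≤1+b β∈ with size≥ (suc b) ∈F? L
    ... | yes _ = β≤1+b
    ... | no  1+b∉ with m≤n⇒m<n∨m≡n β≤1+b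
    ...   | inj₁ β<1+b = largest-max b (≤-pred β<1+b) β∈
    ...   | inj₂ refl  = ⊥-elim (1+b∉ β∈)

    n : ℕ
    n = largest α

    A : List Loc
    A = map store Y

    A-below : ∀ {l} → l ∈ A → l < N
    A-below l∈ with ∈-map⁻ store l∈
    ... | y , y∈ , refl = store-bound (proj₁ (Y-allocated y∈))

    padding : ℕ
    padding = n ∸ length Y

    fillers : List Loc
    fillers = map (N +_) (upTo padding)

    fillers-above : ∀ {l} → l ∈ fillers → N ≤ l
    fillers-above l∈ with ∈-map⁻ (N +_) l∈
    ... | i , _ , refl = m≤m+n N i

    cells : List Loc
    cells = A ++ fillers

    cells-unique : Unique cells
    cells-unique = Unique.++⁺ (AllPairs.map⁺ Y-separated)
                              (Unique.map⁺ (+-cancelˡ-≡ N _ _) (Unique.upTo⁺ _))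
                              λ (l∈A , l∈F) → <⇒≱ (A-below l∈A) (fillers-above l∈F)

    cells-length : length cells ≡ n
    cells-length = begin
      length (A ++ fillers)              ≡⟨ length-++ A ⟩
      length A + length fillers          ≡⟨ cong₂ _+_ (length-map store Y) (length-map (N +_) (upTo padding)) ⟩
      length Y + length (upTo padding)   ≡⟨ cong (length Y +_) (length-upTo padding) ⟩
      length Y + (n ∸ length Y)          ≡⟨ m+[n∸m]≡n (largest-max α Y≤α size-classes) ⟩
      n                                  ∎

    Edge : Loc → Set
    Edge c = Any (λ x → Any (λ y → store x ≡ c × (x ↪ y) ∈ L) X) X

    edge? : ∀ c → Dec (Edge c)
    edge? c = any? (λ x → any? (λ y → (store x ≟ c) ×-dec ((x ↪ y) ∈F? L)) X) X

    target : Loc → Loc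
    target c with edge? c
    ... | yes edge = let (_ , _ , edge′) = find edge ; (y , _) = find edge′ in store y
    ... | no  _    = N

    target-edge : ∀ {c} → Edge c → ∃ λ x → ∃ λ y →
                  x ∈ X × y ∈ X × store x ≡ c × (x ↪ y) ∈ L × target c ≡ store y
    target-edge {c} edge with edge? c
    ... | no ¬edge = ⊥-elim (¬edge edge)
    ... | yes edge′ =
      let (x , x∈ , edge″) = find edge′ ; (y , y∈ , sx≡c , x↪y) = find edge″
      in x , y , x∈ , y∈ , sx≡c , x↪y , refl

    target-none : ∀ {c} → ¬ Edge c → target c ≡ N
    target-none {c} ¬edge with edge? c
    ... | yes edge = ⊥-elim (¬edge edge)
    ... | no  _    = refl

    target-sound : ∀ {x y} → x ∈ X → y ∈ X → (x ↪ y) ∈ L → target (store x) ≡ store y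
    target-sound x∈ y∈ x↪y =
      let (x′ , y′ , x′∈ , y′∈ , same , x′↪y′ , target≡) =
            target-edge (lose x∈ (lose y∈ (refl , x↪y)))
          x↪y′ = ↪-congˡ x′∈ x∈ y′∈ (store-complete x′∈ x∈ same) x′↪y′
      in trans target≡ (store-sound y′∈ y∈ (↪-functional x∈ y′∈ y∈ x↪y′ x↪y))

    target-complete : ∀ {x y} → x ∈ X → y ∈ X → target (store x) ≡ store y → (x ↪ y) ∈ L
    target-complete {x} {y} x∈ y∈ target≡ = by-cases (edge? (store x))
      where
        by-cases : Dec (Edge (store x)) → (x ↪ y) ∈ L
        by-cases (no ¬edge) =
          ⊥-elim (<-irrefl (trans (sym target≡) (target-none ¬edge)) (store-bound y∈))
        by-cases (yes edge) =
          let (x′ , y′ , x′∈ , y′∈ , same , x′↪y′ , target≡′) = target-edge edge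
              y′≐y = store-complete y′∈ y∈ (trans (sym target≡′) target≡)
              x′↪y = ↪-congʳ x′∈ y′∈ y∈ y′≐y x′↪y′
          in ↪-congˡ x′∈ x∈ y∈ (store-complete x′∈ x∈ same) x′↪y

    model : Heap
    model = finiteMap cells target

    cells-allocated : All (_∈dom model) cells
    cells-allocated =
      All.tabulate λ l∈ free → just≢nothing (trans (sym (finiteMap-in l∈)) free)

    cell-iff-alloc : ∀ {x} → x ∈ X → (store x ∈ cells) ⇔ (alloc x ∈ L)
    cell-iff-alloc {x} x∈ = mk⇔ allocated cell
      where
        allocated : store x ∈ cells → alloc x ∈ L
        allocated sx∈ with ∈-++⁻ A sx∈
        ... | inj₂ sx∈F = ⊥-elim (<⇒≱ (store-bound x∈) (fillers-above sx∈F))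
        ... | inj₁ sx∈A with ∈-map⁻ store sx∈A
        ...   | y , y∈ , sx≡sy = let (y∈X , y-alloc) = Y-allocated y∈ in
          alloc-cong y∈X x∈ (store-complete y∈X x∈ (sym sx≡sy)) y-alloc
        cell : alloc x ∈ L → store x ∈ cells
        cell x-alloc = let (y , y∈ , sy≡sx) = Y-covers x∈ x-alloc in
          ∈-++⁺ˡ (subst (_∈ A) sy≡sx (∈-map⁺ store y∈))

    core-sem : ∀ {ψ} → IsCore X α ψ → (store , model ⊨ ψ) ⇔ (ψ ∈ L)
    core-sem (inj₁ (x , y , x∈ , y∈ , refl)) = mk⇔ (store-complete x∈ y∈) (store-sound x∈ y∈)
    core-sem (inj₂ (inj₁ (x , x∈ , refl))) = mk⇔
      (to (cell-iff-alloc x∈) ∘ finiteMap-dom ∘ alloc-elim store model x)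
      (alloc-intro store model x ∘ All.lookup cells-allocated ∘ from (cell-iff-alloc x∈))
    core-sem (inj₂ (inj₂ (inj₁ (x , y , x∈ , y∈ , refl)))) = mk⇔ points pointed
      where
        pointed : (x ↪ y) ∈ L → fun model (store x) ≡ just (store y)
        pointed x↪y = trans (finiteMap-in (from (cell-iff-alloc x∈) (↪-alloc x∈ y∈ x↪y)))
                            (cong just (target-sound x∈ y∈ x↪y))
        points : fun model (store x) ≡ just (store y) → (x ↪ y) ∈ L
        points sx↦sy =
          let sx∈ = finiteMap-dom λ free → just≢nothing (trans (sym sx↦sy) free)
          in target-complete x∈ y∈ (just-injective (trans (sym (finiteMap-in sx∈)) sx↦sy))
    core-sem (inj₂ (inj₂ (inj₂ (β , β≤α , refl)))) = mk⇔
      (λ sized → let β≤n = subst (β ≤_) cells-length (size≥-elim store β model cells finiteMap-dom sized)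
                 in size-downward n β≤n (largest-≤ α) (largest-in α))
      (λ β∈ → size≥-intro store β model cells cells-unique cells-allocated
                (subst (β ≤_) (sym cells-length) (largest-max α β≤α β∈)))

    satisfies : store , model ⊨ Conj L
    satisfies = Conj-intro store model L (All.tabulate literal)
      where
        literal : ∀ {φ} → φ ∈ L → store , model ⊨ φ
        literal φ∈ with proj₁ core-type _ φ∈
        ... | _ , core , inj₁ refl = from (core-sem core) φ∈
        ... | _ , core , inj₂ refl = λ ψ-sat → not-both core (to (core-sem core) ψ-sat) φ∈

  -- A valid negated core type is refuted: otherwise L would be saturated
  -- and the model above would satisfy it.
  completeness : Valid (¬' Conj L) → Refuted
  completeness valid = Sum.[ id , refute-model ]′ check-Saturated
    where refute-model : Saturated → Refuted
          refute-model S = ⊥-elim (valid store (Model.model S) (Model.satisfies S))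

lemma4p1 : (X : List PVar) → Unique X → (α : ℕ) → length X ≤ α →
           (L : List Form) → IsCoreType X α L →
           Valid (¬' Conj L) ⇔ (⊢C ¬' Conj L)
lemma4p1 X _ α X≤α L core-type =
  mk⇔ (Completeness.completeness X α X≤α L core-type) refutation-sound
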